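{- Let $0<a<1$ be real and let $t\ge 1$, $r\ge 2$ and $q\ge r^2/a$ be integers. Then there exists an $r$-uniform hypergraph $H$ with $tq$ vertices such that: (i) $V(H)=T_1\cup T_2\cup\dots\cup T_q$, where the sets $T_1,\dots,T_q$ are pairwise disjoint and $|T_1|=\dots=|T_q|=t$; (ii) every edge of $H$ meets every $T_i$ in at most one vertex; (iii) $\alpha(H)<atq$; (iv) $|E(H)|\le (1/a)^r\cdot 4tq$.
   Context: $\alpha(H)$ denotes the independence number of the hypergraph $H$: the maximum size of a subset of $V(H)$ containing no edge of $H$.
   Formalization: The parameter $a$ ranges over the rationals with $0<a<1$ rather than over the reals. -}

module Defs where

open import Data.Nat using (ℕ; zero; suc) renaming (_*_ to _*ℕ_; _≤_ to _≤ℕ_)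
open import Data.Fin using (Fin)
open import Data.Fin.Subset using (Subset; _∈_; _⊆_; ∣_∣)
open import Data.List using (List)
open import Data.List.Relation.Unary.All using (All)
open import Data.List.Relation.Unary.Unique.Propositional using (Unique)
open import Data.List.Membership.Propositional renaming (_∈_ to _∈ₗ_)
open import Data.Product using (Σ; _×_)
open import Relation.Binary.PropositionalEquality using (_≡_; _≢_)
open import Relation.Nullary using (¬_)
open import Data.Rational using (ℚ; 1ℚ; _*_)

record Hypergraph (n : ℕ) : Set where
  field
    edges  : List (Subset n)
    unique : Unique edges

open Hypergraph public

numEdges : ∀ {n} → Hypergraph n → ℕ
numEdges H = Data.List.length (edges H)

Uniform : ∀ {n} → ℕ → Hypergraph n → Set
Uniform r H = All (λ e → ∣ e ∣ ≡ r) (edges H)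

Independent : ∀ {n} → Hypergraph n → Subset n → Set
Independent H S = All (λ e → ¬ (e ⊆ S)) (edges H)

PartSizes : ∀ {n q} → (Fin n → Fin q) → ℕ → Set
PartSizes {n} {q} part t =
  (i : Fin q) → Σ (Subset n) (λ T → ((v : Fin n) → (v ∈ T → part v ≡ i) × (part v ≡ i → v ∈ T)) × ∣ T ∣ ≡ t)

Transversal : ∀ {n q} → Hypergraph n → (Fin n → Fin q) → Set
Transversal H part =
  All (λ e → ∀ u v → u ∈ e → v ∈ e → part u ≡ part v → u ≡ v) (edges H)

_^ℚ_ : ℚ → ℕ → ℚ
x ^ℚ zero  = 1ℚ
x ^ℚ suc k = x * (x ^ℚ k)

-- The base hypergraph on q vertices consists of m = k q edges, k ≈ 2 (1/a)^r, chosen among the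
-- N = q C r possible r-sets.  A set S with |S| ≥ a q contains c = |S| C r of them, and r² ≤ |S|
-- makes c r! at least half of |S|^r, so that N ≤ k c.  Hence the m-sequences of r-sets missing S
-- number (N - c)^m < N^m / 2^q (Bernoulli), and a union bound over the at most 2^q such S leaves
-- a sequence that meets every one of them: its independence number is below a q.  The required
-- hypergraph is the disjoint union of t copies, with T_i the set of i-th vertices of the copies;
-- an independent set meets every copy in fewer than a q vertices.

module Submission where

module PowerBounds where

  open import Data.Nat
  open import Data.Nat.Properties
  open import Data.Nat.Tactic.RingSolver using (solve-∀)
  open import Relation.Binary.PropositionalEquality
  open import Algebra.Properties.CommutativeSemigroup *-commutativeSemigroup using (interchange; x∙yz≈y∙xz)

  ^-distribʳ-* : ∀ m n o → (m * n) ^ o ≡ m ^ o * n ^ o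
  ^-distribʳ-* m n zero    = refl
  ^-distribʳ-* m n (suc o) = begin
    m * n * (m * n) ^ o      ≡⟨ cong (m * n *_) (^-distribʳ-* m n o) ⟩
    m * n * (m ^ o * n ^ o)  ≡⟨ interchange m n (m ^ o) (n ^ o) ⟩
    m * m ^ o * (n * n ^ o)  ∎
    where open ≡-Reasoning

  bernoulli : ∀ n c k → n ^ k * (n + k * c) ≤ n * (n + c) ^ k
  bernoulli n c zero    = ≤-reflexive (trans (*-identityˡ (n + 0)) (trans (+-identityʳ n) (sym (*-identityʳ n))))
  bernoulli n c (suc k) = begin
    n * n ^ k * (n + suc k * c)
      ≤⟨ m≤m+n _ (n ^ k * (k * c * c)) ⟩
    n * n ^ k * (n + suc k * c) + n ^ k * (k * c * c)
      ≡⟨ expand n c k (n ^ k) ⟩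
    (n + c) * (n ^ k * (n + k * c))
      ≤⟨ *-monoʳ-≤ (n + c) (bernoulli n c k) ⟩
    (n + c) * (n * (n + c) ^ k)
      ≡⟨ x∙yz≈y∙xz (n + c) n ((n + c) ^ k) ⟩
    n * ((n + c) * (n + c) ^ k)  ∎
    where
    open ≤-Reasoning
    expand : ∀ n c k p → n * p * (n + (1 + k) * c) + p * (k * c * c) ≡ (n + c) * (p * (n + k * c))
    expand = solve-∀

  -- With N = c + d: (d / N)^k ≤ (N / (N + c))^k ≤ N / (N + k c) ≤ 1/2, the middle step by Bernoulli.
  2*d^k<[c+d]^k : ∀ {c d} k → 1 ≤ c → c + d ≤ k * c → 2 * d ^ k < (c + d) ^ k
  2*d^k<[c+d]^k {c} {d} k 1≤c N≤kc = *-cancelˡ-< (N ^ k) _ _ (begin-strict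
    N ^ k * (2 * d ^ k)    ≡⟨ regroup (N ^ k) (d ^ k) ⟩
    2 * N ^ k * d ^ k      ≤⟨ *-monoˡ-≤ (d ^ k) 2N^k≤[N+c]^k ⟩
    (N + c) ^ k * d ^ k    ≡⟨ *-comm ((N + c) ^ k) (d ^ k) ⟩
    d ^ k * (N + c) ^ k    ≡⟨ ^-distribʳ-* d (N + c) k ⟨
    (d * (N + c)) ^ k      <⟨ ^-monoˡ-< k {{k≢0}} d[N+c]<N*N ⟩
    (N * N) ^ k            ≡⟨ ^-distribʳ-* N N k ⟩
    N ^ k * N ^ k          ∎)
    where
    open ≤-Reasoning
    N = c + d
    1≤N : 1 ≤ N
    1≤N = ≤-trans 1≤c (m≤m+n c d)
    k≢0 : NonZero k
    k≢0 = m*n≢0⇒m≢0 k {{>-nonZero (≤-trans 1≤N N≤kc)}}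
    regroup : ∀ x y → x * (2 * y) ≡ 2 * x * y
    regroup = solve-∀
    2N^k≤[N+c]^k : 2 * N ^ k ≤ (N + c) ^ k
    2N^k≤[N+c]^k = *-cancelˡ-≤ N {{>-nonZero 1≤N}} (begin
      N * (2 * N ^ k)      ≡⟨ double N (N ^ k) ⟩
      N ^ k * (N + N)      ≤⟨ *-monoʳ-≤ (N ^ k) (+-monoʳ-≤ N N≤kc) ⟩
      N ^ k * (N + k * c)  ≤⟨ bernoulli N c k ⟩
      N * (N + c) ^ k      ∎)
      where
      double : ∀ x y → x * (2 * y) ≡ y * (x + x)
      double = solve-∀
    d[N+c]<N*N : d * (N + c) < N * N
    d[N+c]<N*N = begin-strict
      d * (N + c)          <⟨ m<n+m (d * (N + c)) (*-mono-≤ 1≤c 1≤c) ⟩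
      c * c + d * (N + c)  ≡⟨ square c d ⟩
      N * N                ∎
      where
      square : ∀ c d → c * c + d * (c + d + c) ≡ (c + d) * (c + d)
      square = solve-∀

  2^q*d^[k*q]<[c+d]^[k*q] : ∀ {c d} k q .{{_ : NonZero q}} → 1 ≤ c → c + d ≤ k * c →
                            2 ^ q * d ^ (k * q) < (c + d) ^ (k * q)
  2^q*d^[k*q]<[c+d]^[k*q] {c} {d} k q 1≤c N≤kc = begin-strict
    2 ^ q * d ^ (k * q)    ≡⟨ cong (2 ^ q *_) (^-*-assoc d k q) ⟨
    2 ^ q * (d ^ k) ^ q    ≡⟨ ^-distribʳ-* 2 (d ^ k) q ⟨
    (2 * d ^ k) ^ q        <⟨ ^-monoˡ-< q (2*d^k<[c+d]^k k 1≤c N≤kc) ⟩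
    ((c + d) ^ k) ^ q      ≡⟨ ^-*-assoc (c + d) k q ⟩
    (c + d) ^ (k * q)      ∎
    where open ≤-Reasoning

module Binomial where

  open import Data.Nat
  open import Data.Nat.Properties
  open import Data.Nat.Combinatorics
    using (_C_; nC1≡n; nCk+nC[k+1]≡[n+1]C[k+1])
  open import Data.Nat.Combinatorics.Base using (_P′_)
  open import Data.Nat.Tactic.RingSolver using (solve-∀)
  open import Relation.Binary.PropositionalEquality
  open import Algebra.Properties.CommutativeSemigroup *-commutativeSemigroup using (x∙yz≈y∙xz)

  0<nCk : ∀ {n k} → k ≤ n → 0 < n C k
  0<nCk {n}     {zero}  _         = s≤s z≤n
  0<nCk {suc n} {suc k} (s≤s k≤n) =
    ≤-trans (0<nCk k≤n) (≤-trans (m≤m+n (n C k) (n C suc k)) (≤-reflexive (nCk+nC[k+1]≡[n+1]C[k+1] n k)))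

  [1+k]*[1+n]C[1+k]≡[1+n]*nCk : ∀ n k → suc k * (suc n C suc k) ≡ suc n * (n C k)
  [1+k]*[1+n]C[1+k]≡[1+n]*nCk n       zero    = trans (*-identityˡ _) (trans (nC1≡n (suc n)) (sym (*-identityʳ (suc n))))
  [1+k]*[1+n]C[1+k]≡[1+n]*nCk zero    (suc k) = *-zeroʳ (suc (suc k))
  [1+k]*[1+n]C[1+k]≡[1+n]*nCk (suc n) (suc k) = begin
    (2 + k) * ((2 + n) C (2 + k))
      ≡⟨ cong ((2 + k) *_) (nCk+nC[k+1]≡[n+1]C[k+1] (1 + n) (1 + k)) ⟨
    (2 + k) * (A + (1 + n) C (2 + k))
      ≡⟨ regroup k A ((1 + n) C (2 + k)) ⟩
    A + (1 + k) * A + (2 + k) * ((1 + n) C (2 + k))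
      ≡⟨ cong₂ (λ x y → A + x + y) ([1+k]*[1+n]C[1+k]≡[1+n]*nCk n k) ([1+k]*[1+n]C[1+k]≡[1+n]*nCk n (1 + k)) ⟩
    A + (1 + n) * (n C k) + (1 + n) * (n C (1 + k))
      ≡⟨ +-assoc A _ _ ⟩
    A + ((1 + n) * (n C k) + (1 + n) * (n C (1 + k)))
      ≡⟨ cong (A +_) (*-distribˡ-+ (1 + n) (n C k) (n C (1 + k))) ⟨
    A + (1 + n) * (n C k + n C (1 + k))
      ≡⟨ cong (λ x → A + (1 + n) * x) (nCk+nC[k+1]≡[n+1]C[k+1] n k) ⟩
    A + (1 + n) * A
      ∎
    where
    open ≡-Reasoning
    A = (1 + n) C (1 + k)
    regroup : ∀ k a b → (2 + k) * (a + b) ≡ a + (1 + k) * a + (2 + k) * b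
    regroup = solve-∀

  [1+n]P′[1+k]≡[1+n]*nP′k : ∀ n k → suc n P′ suc k ≡ suc n * (n P′ k)
  [1+n]P′[1+k]≡[1+n]*nP′k n zero    = refl
  [1+n]P′[1+k]≡[1+n]*nP′k n (suc k) = begin
    (n ∸ k) * (suc n P′ suc k)    ≡⟨ cong ((n ∸ k) *_) ([1+n]P′[1+k]≡[1+n]*nP′k n k) ⟩
    (n ∸ k) * (suc n * (n P′ k))  ≡⟨ x∙yz≈y∙xz (n ∸ k) (suc n) (n P′ k) ⟩
    suc n * (n P′ suc k)          ∎
    where open ≡-Reasoning

  k!*nCk≡nP′k : ∀ n k → k ! * (n C k) ≡ n P′ k
  k!*nCk≡nP′k n       zero    = refl
  k!*nCk≡nP′k zero    (suc k) = trans (*-zeroʳ (suc k !)) (sym (cong (_* (0 P′ k)) (0∸n≡0 k)))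
  k!*nCk≡nP′k (suc n) (suc k) = begin
    suc k * k ! * (suc n C suc k)    ≡⟨ *-assoc (suc k) (k !) _ ⟩
    suc k * (k ! * (suc n C suc k))  ≡⟨ x∙yz≈y∙xz (suc k) (k !) _ ⟩
    k ! * (suc k * (suc n C suc k))  ≡⟨ cong (k ! *_) ([1+k]*[1+n]C[1+k]≡[1+n]*nCk n k) ⟩
    k ! * (suc n * (n C k))          ≡⟨ x∙yz≈y∙xz (k !) (suc n) (n C k) ⟩
    suc n * (k ! * (n C k))          ≡⟨ cong (suc n *_) (k!*nCk≡nP′k n k) ⟩
    suc n * (n P′ k)                 ≡⟨ [1+n]P′[1+k]≡[1+n]*nP′k n k ⟨
    suc n P′ suc k                   ∎
    where open ≡-Reasoning

  nP′k≤n^k : ∀ n k → n P′ k ≤ n ^ k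
  nP′k≤n^k n zero    = ≤-refl
  nP′k≤n^k n (suc k) = *-mono-≤ (m∸n≤m n k) (nP′k≤n^k n k)

  -- The Weierstrass product inequality ∏ᵢ (1 - i/n) ≥ 1 - Σᵢ i/n, cleared of denominators.
  2*n^[1+k]≤2*n*nP′k+k*k*n^k : ∀ {n} k → k ≤ n → 2 * n ^ suc k ≤ 2 * n * (n P′ k) + k * k * n ^ k
  2*n^[1+k]≤2*n*nP′k+k*k*n^k {n} zero    _     = ≤-reflexive (base n)
    where
    base : ∀ n → 2 * (n * 1) ≡ 2 * n * 1 + 0 * 0 * 1
    base = solve-∀
  2*n^[1+k]≤2*n*nP′k+k*k*n^k {n} (suc k) 1+k≤n = begin
    2 * (n * X)
      ≡⟨ cong (λ m → 2 * (m * X)) (m∸n+n≡m k≤n) ⟨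
    2 * ((u + k) * X)
      ≡⟨ split u k X ⟩
    u * (2 * X) + 2 * k * X
      ≤⟨ +-monoˡ-≤ (2 * k * X) (*-monoʳ-≤ u (2*n^[1+k]≤2*n*nP′k+k*k*n^k k k≤n)) ⟩
    u * (2 * n * P + k * k * n ^ k) + 2 * k * X
      ≡⟨ cong (_+ 2 * k * X) (regroup u n P k (n ^ k)) ⟩
    2 * n * (u * P) + k * k * (u * n ^ k) + 2 * k * X
      ≤⟨ +-monoˡ-≤ (2 * k * X) (+-monoʳ-≤ (2 * n * (u * P)) (*-monoʳ-≤ (k * k) (*-monoˡ-≤ (n ^ k) (m∸n≤m n k)))) ⟩
    2 * n * (u * P) + k * k * X + 2 * k * X
      ≤⟨ absorb-square (2 * n * (u * P)) k X ⟩
    2 * n * (u * P) + suc k * suc k * X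
      ∎
    where
    open ≤-Reasoning
    k≤n = ≤-trans (n≤1+n k) 1+k≤n
    u = n ∸ k
    P = n P′ k
    X = n ^ suc k
    split : ∀ u k x → 2 * ((u + k) * x) ≡ u * (2 * x) + 2 * k * x
    split = solve-∀
    regroup : ∀ u n p k y → u * (2 * n * p + k * k * y) ≡ 2 * n * (u * p) + k * k * (u * y)
    regroup = solve-∀
    absorb-square : ∀ a k x → a + k * k * x + 2 * k * x ≤ a + suc k * suc k * x
    absorb-square a k x = ≤-trans (m≤m+n _ x) (≤-reflexive (square a k x))
      where
      square : ∀ a k x → a + k * k * x + 2 * k * x + x ≡ a + (1 + k) * (1 + k) * x
      square = solve-∀

  n^k≤2*nP′k : ∀ {n k} → 1 ≤ n → k * k ≤ n → n ^ k ≤ 2 * (n P′ k)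
  n^k≤2*nP′k {n} {k} 1≤n k*k≤n = *-cancelˡ-≤ n {{>-nonZero 1≤n}} (+-cancelʳ-≤ (n * n ^ k) _ _ (begin
    n * n ^ k + n * n ^ k          ≡⟨ double (n * n ^ k) ⟩
    2 * (n * n ^ k)                ≤⟨ 2*n^[1+k]≤2*n*nP′k+k*k*n^k k (≤-trans (m≤m*m k) k*k≤n) ⟩
    2 * n * P + k * k * n ^ k      ≤⟨ +-monoʳ-≤ (2 * n * P) (*-monoˡ-≤ (n ^ k) k*k≤n) ⟩
    2 * n * P + n * n ^ k          ≡⟨ cong (_+ n * n ^ k) (*-comm-middle n P) ⟩
    n * (2 * P) + n * n ^ k        ∎))
    where
    open ≤-Reasoning
    P = n P′ k
    double : ∀ x → x + x ≡ 2 * x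
    double = solve-∀
    *-comm-middle : ∀ n p → 2 * n * p ≡ n * (2 * p)
    *-comm-middle = solve-∀
    m≤m*m : ∀ m → m ≤ m * m
    m≤m*m zero    = z≤n
    m≤m*m (suc m) = m≤m*n (suc m) (suc m)

  nCk≤m*sCk : ∀ {n s k m} → 1 ≤ s → k * k ≤ s → 2 * n ^ k ≤ m * s ^ k → n C k ≤ m * (s C k)
  nCk≤m*sCk {n} {s} {k} {m} 1≤s k*k≤s 2n^k≤ms^k = *-cancelˡ-≤ (2 * k !) {{m*n≢0 2 (k !) {{_}} {{k !≢0}}}} (begin
    2 * k ! * (n C k)        ≡⟨ *-assoc 2 (k !) (n C k) ⟩
    2 * (k ! * (n C k))      ≡⟨ cong (2 *_) (k!*nCk≡nP′k n k) ⟩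
    2 * (n P′ k)               ≤⟨ *-monoʳ-≤ 2 (nP′k≤n^k n k) ⟩
    2 * n ^ k                ≤⟨ 2n^k≤ms^k ⟩
    m * s ^ k                ≤⟨ *-monoʳ-≤ m (n^k≤2*nP′k {k = k} 1≤s k*k≤s) ⟩
    m * (2 * (s P′ k))         ≡⟨ cong (λ x → m * (2 * x)) (k!*nCk≡nP′k s k) ⟨
    m * (2 * (k ! * (s C k)))  ≡⟨ regroup m (k !) (s C k) ⟩
    2 * k ! * (m * (s C k))    ∎)
    where
    open ≤-Reasoning
    regroup : ∀ m f c → m * (2 * (f * c)) ≡ 2 * f * (m * c)
    regroup = solve-∀

module Counting where

  open import Data.Nat
  open import Data.Nat.Properties
  open import Data.Nat.ListAction using (sum)
  open import Data.Bool using (true; false)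
  open import Data.List using (List; []; _∷_; [_]; _++_; map; length; filter; cartesianProductWith)
  open import Data.List.Properties using (length-++; length-map; map-cong; filter-++; filter-accept; filter-reject)
  open import Data.List.Relation.Unary.All as All using (All; []; _∷_)
  open import Data.List.Relation.Unary.All.Properties using (¬Any⇒All¬; ¬All⇒Any¬)
  open import Data.List.Relation.Unary.Any as Any using (Any; here; there; any?)
  open import Data.List.Membership.Propositional using (_∈_; find)
  open import Data.List.Membership.Propositional.Properties using (∈-cartesianProductWith⁻)
  open import Data.Product using (Σ; _×_; _,_)
  open import Relation.Nullary using (¬_; Dec; yes; no; does; ¬?; contradiction)
  open import Relation.Unary using (Decidable)
  open import Relation.Binary.PropositionalEquality hiding ([_])

  private variable
    A B : Set

  length-cartesianProductWith : ∀ {C : Set} (f : A → B → C) xs ys →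
                                length (cartesianProductWith f xs ys) ≡ length xs * length ys
  length-cartesianProductWith f []       ys = refl
  length-cartesianProductWith f (x ∷ xs) ys = begin
    length (map (f x) ys ++ cartesianProductWith f xs ys)     ≡⟨ length-++ (map (f x) ys) ⟩
    length (map (f x) ys) + length (cartesianProductWith f xs ys)
      ≡⟨ cong₂ _+_ (length-map (f x) ys) (length-cartesianProductWith f xs ys) ⟩
    length ys + length xs * length ys                         ∎
    where open ≡-Reasoning

  sequences : ℕ → List A → List (List A)
  sequences zero    xs = [ [] ]
  sequences (suc m) xs = cartesianProductWith _∷_ xs (sequences m xs)

  length-sequences : ∀ m (xs : List A) → length (sequences m xs) ≡ length xs ^ m
  length-sequences zero    xs = refl
  length-sequences (suc m) xs =
    trans (length-cartesianProductWith _∷_ xs (sequences m xs)) (cong (length xs *_) (length-sequences m xs))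

  ∈-sequences⁻ : ∀ m (xs : List A) {σ} → σ ∈ sequences m xs → length σ ≡ m × All (_∈ xs) σ
  ∈-sequences⁻ zero    xs (here refl) = refl , []
  ∈-sequences⁻ (suc m) xs σ∈ with ∈-cartesianProductWith⁻ _∷_ xs (sequences m xs) σ∈
  ... | x , σ , x∈xs , σ∈seqs , refl with ∈-sequences⁻ m xs σ∈seqs
  ...   | |σ|≡m , σ⊆xs = cong suc |σ|≡m , x∈xs ∷ σ⊆xs

  module _ {P : A → Set} (P? : Decidable P) where

    private
      all-P? : Decidable (All P)
      all-P? = All.all? P?

    filter-all-map-∷-accept : ∀ {x} → P x → (σs : List (List A)) →
                              filter all-P? (map (x ∷_) σs) ≡ map (x ∷_) (filter all-P? σs)
    filter-all-map-∷-accept px []       = refl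
    filter-all-map-∷-accept {x} px (σ ∷ σs) = by-cases (all-P? σ)
      where
      open ≡-Reasoning
      by-cases : Dec (All P σ) → filter all-P? (map (x ∷_) (σ ∷ σs)) ≡ map (x ∷_) (filter all-P? (σ ∷ σs))
      by-cases (yes pσ) = begin
        filter all-P? ((x ∷ σ) ∷ map (x ∷_) σs)     ≡⟨ filter-accept all-P? (px ∷ pσ) ⟩
        (x ∷ σ) ∷ filter all-P? (map (x ∷_) σs)     ≡⟨ cong ((x ∷ σ) ∷_) (filter-all-map-∷-accept px σs) ⟩
        map (x ∷_) (σ ∷ filter all-P? σs)           ≡⟨ cong (map (x ∷_)) (filter-accept all-P? pσ) ⟨
        map (x ∷_) (filter all-P? (σ ∷ σs))         ∎
      by-cases (no ¬pσ) = begin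
        filter all-P? ((x ∷ σ) ∷ map (x ∷_) σs)     ≡⟨ filter-reject all-P? {x ∷ σ} (λ { (_ ∷ pσ) → ¬pσ pσ }) ⟩
        filter all-P? (map (x ∷_) σs)               ≡⟨ filter-all-map-∷-accept px σs ⟩
        map (x ∷_) (filter all-P? σs)               ≡⟨ cong (map (x ∷_)) (filter-reject all-P? ¬pσ) ⟨
        map (x ∷_) (filter all-P? (σ ∷ σs))         ∎

    filter-all-map-∷-reject : ∀ {x} → ¬ P x → (σs : List (List A)) → filter all-P? (map (x ∷_) σs) ≡ []
    filter-all-map-∷-reject ¬px []       = refl
    filter-all-map-∷-reject ¬px (σ ∷ σs) =
      trans (filter-reject all-P? {_ ∷ σ} (λ { (px ∷ _) → ¬px px })) (filter-all-map-∷-reject ¬px σs)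

    length-filter-all-cartesianProductWith-∷ : ∀ xs σs →
      length (filter all-P? (cartesianProductWith _∷_ xs σs)) ≡ length (filter P? xs) * length (filter all-P? σs)
    length-filter-all-cartesianProductWith-∷ []       σs = refl
    length-filter-all-cartesianProductWith-∷ (x ∷ xs) σs
      rewrite filter-++ all-P? (map (x ∷_) σs) (cartesianProductWith _∷_ xs σs)
            | length-++ (filter all-P? (map (x ∷_) σs)) {filter all-P? (cartesianProductWith _∷_ xs σs)}
            | length-filter-all-cartesianProductWith-∷ xs σs
      with P? x
    ... | yes px rewrite filter-all-map-∷-accept px σs = cong (_+ _) (length-map (x ∷_) (filter all-P? σs))
    ... | no ¬px rewrite filter-all-map-∷-reject ¬px σs = refl

    length-filter-all-sequences : ∀ m xs → length (filter all-P? (sequences m xs)) ≡ length (filter P? xs) ^ m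
    length-filter-all-sequences zero    xs = refl
    length-filter-all-sequences (suc m) xs =
      trans (length-filter-all-cartesianProductWith-∷ xs (sequences m xs))
            (cong (length (filter P? xs) *_) (length-filter-all-sequences m xs))

  length-filter+length-filter-¬ : ∀ {P : A → Set} (P? : Decidable P) xs →
                                  length (filter P? xs) + length (filter (λ x → ¬? (P? x)) xs) ≡ length xs
  length-filter+length-filter-¬ P? []       = refl
  length-filter+length-filter-¬ P? (x ∷ xs) with P? x
  ... | yes _ = cong suc (length-filter+length-filter-¬ P? xs)
  ... | no _  = trans (+-suc _ _) (cong suc (length-filter+length-filter-¬ P? xs))

  sum-map-mono-< : ∀ {f g : A → ℕ} xs → (∀ x → f x ≤ g x) → Any (λ x → f x < g x) xs →
                   sum (map f xs) < sum (map g xs)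
  sum-map-mono-< (x ∷ xs) f≤g (here fx<gx)  = +-mono-<-≤ fx<gx (sum-map-mono-≤ xs)
    where
    sum-map-mono-≤ : ∀ xs → sum (map _ xs) ≤ sum (map _ xs)
    sum-map-mono-≤ []       = z≤n
    sum-map-mono-≤ (x ∷ xs) = +-mono-≤ (f≤g x) (sum-map-mono-≤ xs)
  sum-map-mono-< (x ∷ xs) f≤g (there fx<gx) = +-mono-≤-< (f≤g x) (sum-map-mono-< xs f≤g fx<gx)

  sum-map-< : ∀ (f : A → ℕ) xs {b} → 0 < b → All (λ x → length xs * f x < b) xs → sum (map f xs) < b
  sum-map-< f []           0<b _   = 0<b
  sum-map-< f xs@(_ ∷ _) {b} _ n*f<b = *-cancelˡ-< n _ _ (begin-strict
    n * sum (map f xs)         <⟨ m<m+n _ (s≤s z≤n) ⟩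
    n * sum (map f xs) + n     ≤⟨ bound xs n*f<b ⟩
    n * b                      ∎)
    where
    open ≤-Reasoning
    n = length xs
    bound : ∀ ys → All (λ x → n * f x < b) ys → n * sum (map f ys) + length ys ≤ length ys * b
    bound []       []             = ≤-reflexive (trans (+-identityʳ (n * 0)) (*-zeroʳ n))
    bound (y ∷ ys) (n*fy<b ∷ ps) = begin
      n * (f y + sum (map f ys)) + suc (length ys)
        ≡⟨ regroup n (f y) (sum (map f ys)) (length ys) ⟩
      suc (n * f y) + (n * sum (map f ys) + length ys)
        ≤⟨ +-mono-≤ n*fy<b (bound ys ps) ⟩
      b + length ys * b  ∎
      where
      regroup : ∀ n a s l → n * (a + s) + suc l ≡ suc (n * a) + (n * s + l)
      regroup n a s l = trans (+-suc _ l) (cong suc (trans (cong (_+ l) (*-distribˡ-+ n a s)) (+-assoc (n * a) (n * s) l)))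

  length≤sum-length-filter : ∀ {P : B → A → Set} (P? : ∀ t → Decidable (P t)) ts xs →
                             All (λ x → Any (λ t → P t x) ts) xs →
                             length xs ≤ sum (map (λ t → length (filter (P? t) xs)) ts)
  length≤sum-length-filter P? ts []       []            = z≤n
  length≤sum-length-filter {P = P} P? ts (x ∷ xs) (hit ∷ hits) =
    ≤-<-trans (length≤sum-length-filter P? ts xs hits) (sum-map-mono-< ts grow (Any.map (λ {t} → grow-strict t) hit))
    where
    grow : ∀ t → length (filter (P? t) xs) ≤ length (filter (P? t) (x ∷ xs))
    grow t with does (P? t x)
    ... | true  = n≤1+n _
    ... | false = ≤-refl
    grow-strict : ∀ t → P t x → length (filter (P? t) xs) < length (filter (P? t) (x ∷ xs))
    grow-strict t ptx = ≤-reflexive (sym (cong length (filter-accept (P? t) ptx)))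

  module _ {R : A → B → Set} (R? : ∀ x t → Dec (R x t)) where

    hitting-sequence : ∀ m (xs : List A) (ts : List B) → 0 < length xs →
      All (λ t → length ts * length (filter (λ x → ¬? (R? x t)) xs) ^ m < length xs ^ m) ts →
      Σ (List A) λ σ → length σ ≡ m × All (_∈ xs) σ × All (λ t → Any (λ x → R x t) σ) ts
    hitting-sequence m xs ts 0<|xs| few-misses with any? hits-all? (sequences m xs)
      where
      hits-all? : ∀ σ → Dec (All (λ t → Any (λ x → R x t) σ) ts)
      hits-all? σ = All.all? (λ t → any? (λ x → R? x t) σ) ts
    ... | yes some-hit =
      let σ , σ∈ , hit = find some-hit
          |σ|≡m , σ⊆xs = ∈-sequences⁻ m xs σ∈
      in σ , |σ|≡m , σ⊆xs , hit
    ... | no none-hit = contradiction union-bound (<-irrefl refl)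
      where
      N = length xs
      misses? : ∀ t → Decidable (All (λ x → ¬ R x t))
      misses? t = All.all? (λ x → ¬? (R? x t))
      each-misses : All (λ σ → Any (λ t → All (λ x → ¬ R x t) σ) ts) (sequences m xs)
      each-misses = All.map (λ ¬hit → Any.map (¬Any⇒All¬ _) (¬All⇒Any¬ (λ t → any? (λ x → R? x t) _) ts ¬hit))
                            (¬Any⇒All¬ _ none-hit)
      union-bound : N ^ m < N ^ m
      union-bound = begin-strict
        N ^ m
          ≡⟨ length-sequences m xs ⟨
        length (sequences m xs)
          ≤⟨ length≤sum-length-filter misses? ts (sequences m xs) each-misses ⟩
        sum (map (λ t → length (filter (misses? t) (sequences m xs))) ts)
          ≡⟨ cong sum (map-cong (λ t → length-filter-all-sequences (λ x → ¬? (R? x t)) m xs) ts) ⟩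
        sum (map (λ t → length (filter (λ x → ¬? (R? x t)) xs) ^ m) ts)
          <⟨ sum-map-< _ ts (m^n>0 N {{>-nonZero 0<|xs|}} m) few-misses ⟩
        N ^ m  ∎
        where open ≤-Reasoning

module SubsetEnumeration where

  open import Data.Nat
  open import Data.Nat.Properties using (+-comm; +-identityʳ)
  open import Data.Nat.Combinatorics using (_C_; nCk+nC[k+1]≡[n+1]C[k+1])
  open import Data.List using (List; []; _∷_; [_]; _++_; map; length; filter; cartesianProductWith)
  open import Data.List.Properties using (length-++; length-map; filter-++)
  open import Data.List.Relation.Unary.All as All using (All)
  open import Data.List.Relation.Unary.All.Properties using (++⁺; map⁺)
  open import Data.List.Relation.Unary.Any using (here; there)
  open import Data.List.Membership.Propositional using (_∈_)
  open import Data.List.Membership.Propositional.Properties using (∈-cartesianProductWith⁺)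
  open import Data.Vec as Vec using ([]; _∷_)
  open import Data.Fin.Subset using (Subset; inside; outside; ∣_∣)
  open import Data.Fin.Subset.Properties using (_⊆?_)
  open import Relation.Nullary using (yes; no)
  open import Relation.Binary.PropositionalEquality hiding ([_])
  open Counting using (length-cartesianProductWith)

  subsets : ∀ n → List (Subset n)
  subsets zero    = [ [] ]
  subsets (suc n) = cartesianProductWith _∷_ (outside ∷ inside ∷ []) (subsets n)

  length-subsets : ∀ n → length (subsets n) ≡ 2 ^ n
  length-subsets zero    = refl
  length-subsets (suc n) =
    trans (length-cartesianProductWith _∷_ (outside ∷ inside ∷ []) (subsets n)) (cong (2 *_) (length-subsets n))

  ∈-subsets : ∀ {n} (S : Subset n) → S ∈ subsets n
  ∈-subsets []            = here refl
  ∈-subsets (outside ∷ S) = ∈-cartesianProductWith⁺ Vec._∷_ {xs = outside ∷ inside ∷ []} (here refl) (∈-subsets S)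
  ∈-subsets (inside ∷ S)  = ∈-cartesianProductWith⁺ Vec._∷_ {xs = outside ∷ inside ∷ []} (there (here refl)) (∈-subsets S)

  combinations : (n k : ℕ) → List (Subset n)
  combinations zero    zero    = [ [] ]
  combinations zero    (suc k) = []
  combinations (suc n) zero    = map (outside ∷_) (combinations n zero)
  combinations (suc n) (suc k) = map (outside ∷_) (combinations n (suc k)) ++ map (inside ∷_) (combinations n k)

  ∣∣≡k-combinations : (n k : ℕ) → All (λ e → ∣ e ∣ ≡ k) (combinations n k)
  ∣∣≡k-combinations zero    zero    = refl All.∷ All.[]
  ∣∣≡k-combinations zero    (suc k) = All.[]
  ∣∣≡k-combinations (suc n) zero    = map⁺ {f = outside ∷_} (∣∣≡k-combinations n zero)
  ∣∣≡k-combinations (suc n) (suc k) =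
    ++⁺ (map⁺ {f = outside ∷_} (∣∣≡k-combinations n (suc k)))
        (map⁺ {f = inside ∷_} (All.map (cong suc) (∣∣≡k-combinations n k)))

  length-combinations : (n k : ℕ) → length (combinations n k) ≡ n C k
  length-combinations zero    zero    = refl
  length-combinations zero    (suc k) = refl
  length-combinations (suc n) zero    =
    trans (length-map (outside Vec.∷_) (combinations n zero)) (length-combinations n zero)
  length-combinations (suc n) (suc k) = begin
    length (map (outside ∷_) (combinations n (suc k)) ++ map (inside ∷_) (combinations n k))
      ≡⟨ length-++ (map (outside ∷_) (combinations n (suc k))) ⟩
    length (map (outside ∷_) (combinations n (suc k))) + length (map (inside ∷_) (combinations n k))
      ≡⟨ cong₂ _+_ (trans (length-map (outside Vec.∷_) (combinations n (suc k))) (length-combinations n (suc k)))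
                   (trans (length-map (inside Vec.∷_) (combinations n k)) (length-combinations n k)) ⟩
    n C suc k + n C k
      ≡⟨ +-comm (n C suc k) (n C k) ⟩
    n C k + n C suc k
      ≡⟨ nCk+nC[k+1]≡[n+1]C[k+1] n k ⟩
    suc n C suc k ∎
    where open ≡-Reasoning

  module _ {n} (S : Subset n) where

    length-filter-⊆-map-outside : ∀ b es →
      length (filter (_⊆? b ∷ S) (map (outside Vec.∷_) es)) ≡ length (filter (_⊆? S) es)
    length-filter-⊆-map-outside b []       = refl
    length-filter-⊆-map-outside b (e ∷ es) with e ⊆? S
    ... | yes _ = cong suc (length-filter-⊆-map-outside b es)
    ... | no _  = length-filter-⊆-map-outside b es

    length-filter-⊆-map-inside : ∀ es →
      length (filter (_⊆? inside ∷ S) (map (inside Vec.∷_) es)) ≡ length (filter (_⊆? S) es)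
    length-filter-⊆-map-inside []       = refl
    length-filter-⊆-map-inside (e ∷ es) with e ⊆? S
    ... | yes _ = cong suc (length-filter-⊆-map-inside es)
    ... | no _  = length-filter-⊆-map-inside es

    length-filter-⊆-outside-map-inside : ∀ es → length (filter (_⊆? outside ∷ S) (map (inside Vec.∷_) es)) ≡ 0
    length-filter-⊆-outside-map-inside []       = refl
    length-filter-⊆-outside-map-inside (e ∷ es) = length-filter-⊆-outside-map-inside es

  length-filter-⊆-combinations : ∀ {n} (S : Subset n) k → length (filter (_⊆? S) (combinations n k)) ≡ ∣ S ∣ C k
  length-filter-⊆-combinations []      zero    = refl
  length-filter-⊆-combinations []      (suc k) = refl
  length-filter-⊆-combinations (b ∷ S) zero    =
    trans (length-filter-⊆-map-outside S b (combinations _ zero)) (length-filter-⊆-combinations S zero)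
  length-filter-⊆-combinations {suc n} (b ∷ S) (suc k) = begin
    length (filter (_⊆? b ∷ S) (map (outside Vec.∷_) Cs₁ ++ map (inside Vec.∷_) Cs))
      ≡⟨ cong length (filter-++ (_⊆? b ∷ S) (map (outside Vec.∷_) Cs₁) (map (inside Vec.∷_) Cs)) ⟩
    length (filter (_⊆? b ∷ S) (map (outside Vec.∷_) Cs₁) ++ filter (_⊆? b ∷ S) (map (inside Vec.∷_) Cs))
      ≡⟨ length-++ (filter (_⊆? b ∷ S) (map (outside Vec.∷_) Cs₁)) ⟩
    length (filter (_⊆? b ∷ S) (map (outside Vec.∷_) Cs₁)) + length (filter (_⊆? b ∷ S) (map (inside Vec.∷_) Cs))
      ≡⟨ cong (_+ length (filter (_⊆? b ∷ S) (map (inside Vec.∷_) Cs)))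
              (trans (length-filter-⊆-map-outside S b Cs₁) (length-filter-⊆-combinations S (suc k))) ⟩
    ∣ S ∣ C suc k + length (filter (_⊆? b ∷ S) (map (inside Vec.∷_) Cs))
      ≡⟨ pascal b ⟩
    ∣ b ∷ S ∣ C suc k ∎
    where
    open ≡-Reasoning
    Cs₁ = combinations n (suc k)
    Cs  = combinations n k
    pascal : ∀ b → ∣ S ∣ C suc k + length (filter (_⊆? b ∷ S) (map (inside Vec.∷_) Cs)) ≡ ∣ b ∷ S ∣ C suc k
    pascal outside = trans (cong (∣ S ∣ C suc k +_) (length-filter-⊆-outside-map-inside S Cs)) (+-identityʳ _)
    pascal inside  = begin
      ∣ S ∣ C suc k + length (filter (_⊆? inside ∷ S) (map (inside Vec.∷_) Cs))
        ≡⟨ cong (∣ S ∣ C suc k +_) (trans (length-filter-⊆-map-inside S Cs) (length-filter-⊆-combinations S k)) ⟩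
      ∣ S ∣ C suc k + ∣ S ∣ C k
        ≡⟨ +-comm (∣ S ∣ C suc k) (∣ S ∣ C k) ⟩
      ∣ S ∣ C k + ∣ S ∣ C suc k
        ≡⟨ nCk+nC[k+1]≡[n+1]C[k+1] ∣ S ∣ k ⟩
      suc ∣ S ∣ C suc k ∎

module CoveringFamily where

  open import Data.Nat
  open import Data.Nat.Properties
  open import Data.Nat.Combinatorics using (_C_)
  open import Data.List using (List; length; filter)
  open import Data.List.Properties using (length-filter)
  open import Data.List.Relation.Unary.All as All using (All)
  open import Data.List.Relation.Unary.Any using (Any)
  open import Data.List.Membership.Propositional using (_∈_)
  open import Data.List.Membership.Propositional.Properties using (∈-filter⁺; ∈-filter⁻)
  open import Data.Fin.Subset using (Subset; _⊆_; ∣_∣)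
  open import Data.Fin.Subset.Properties using (_⊆?_)
  open import Data.Product using (Σ; _×_; _,_; proj₁; proj₂)
  open import Relation.Nullary using (¬?)
  open import Relation.Unary using (Decidable)
  open import Relation.Binary.PropositionalEquality
  open PowerBounds using (2^q*d^[k*q]<[c+d]^[k*q])
  open Binomial using (0<nCk)
  open Counting using (hitting-sequence; length-filter+length-filter-¬)
  open SubsetEnumeration

  covering-family : ∀ {q} r k .{{_ : NonZero q}} {Big : Subset q → Set} → Decidable Big → r ≤ q →
    (∀ S → Big S → r ≤ ∣ S ∣ × q C r ≤ k * (∣ S ∣ C r)) →
    Σ (List (Subset q)) λ L → length L ≡ k * q × All (λ e → ∣ e ∣ ≡ r) L × (∀ S → Big S → Any (_⊆ S) L)
  covering-family {q} r k Big? r≤q big⇒dense =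
    let L , |L|≡kq , L⊆E , hits = hitting-sequence _⊆?_ (k * q) E Ts 0<|E| (All.tabulate few-misses)
    in L , |L|≡kq , All.map (All.lookup (∣∣≡k-combinations q r)) L⊆E ,
       λ S big → All.lookup hits (∈-filter⁺ Big? (∈-subsets S) big)
    where
    E  = combinations q r
    Ts = filter Big? (subsets q)
    0<|E| : 0 < length E
    0<|E| = subst (0 <_) (sym (length-combinations q r)) (0<nCk r≤q)
    few-misses : ∀ {S} → S ∈ Ts → length Ts * length (filter (λ e → ¬? (e ⊆? S)) E) ^ (k * q) < length E ^ (k * q)
    few-misses {S} S∈Ts = begin-strict
      length Ts * d ^ (k * q)  ≤⟨ *-monoˡ-≤ (d ^ (k * q)) |Ts|≤2^q ⟩
      2 ^ q * d ^ (k * q)      <⟨ 2^q*d^[k*q]<[c+d]^[k*q] k q 1≤c c+d≤k*c ⟩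
      (c + d) ^ (k * q)        ≡⟨ cong (_^ (k * q)) c+d≡|E| ⟩
      length E ^ (k * q)       ∎
      where
      open ≤-Reasoning
      c = length (filter (_⊆? S) E)
      d = length (filter (λ e → ¬? (e ⊆? S)) E)
      dense = big⇒dense S (proj₂ (∈-filter⁻ Big? {xs = subsets q} S∈Ts))
      c≡|S|Cr : c ≡ ∣ S ∣ C r
      c≡|S|Cr = length-filter-⊆-combinations S r
      c+d≡|E| : c + d ≡ length E
      c+d≡|E| = length-filter+length-filter-¬ (_⊆? S) E
      1≤c : 1 ≤ c
      1≤c = subst (1 ≤_) (sym c≡|S|Cr) (0<nCk (proj₁ dense))
      c+d≤k*c : c + d ≤ k * c
      c+d≤k*c = begin
        c + d      ≡⟨ trans c+d≡|E| (length-combinations q r) ⟩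
        q C r      ≤⟨ proj₂ dense ⟩
        k * (∣ S ∣ C r)  ≡⟨ cong (k *_) c≡|S|Cr ⟨
        k * c      ∎
      |Ts|≤2^q : length Ts ≤ 2 ^ q
      |Ts|≤2^q = subst (length Ts ≤_) (length-subsets q) (length-filter Big? (subsets q))

module DisjointCopies where

  open import Data.Nat using (ℕ; zero; suc; _+_; _*_)
  open import Data.Nat.Properties using (+-identityʳ)
  open import Data.Fin using (Fin; splitAt; _↑ˡ_; _↑ʳ_)
  open import Data.Fin.Properties using (splitAt-↑ˡ; splitAt-↑ʳ; splitAt⁻¹-↑ˡ; splitAt⁻¹-↑ʳ)
  open import Data.Fin.Subset using (Subset; inside; outside; _∈_; _⊆_; ⊥; ⁅_⁆; ∣_∣)
  open import Data.Fin.Subset.Properties using (∉⊥; ⊥⊆; ∣⊥∣≡0; x∈⁅x⁆; x∈⁅y⁆⇒x≡y; ∣⁅x⁆∣≡1)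
  open import Data.List as L using (List; map; length)
  open import Data.List.Properties using (length-++; length-map)
  open import Data.List.Relation.Unary.All as All using (All)
  open import Data.List.Relation.Unary.All.Properties using (++⁺; ++⁻; map⁺; map⁻)
  open import Data.Vec using ([]; _∷_; _++_)
  open import Data.Vec.Properties using (lookup-++ˡ; lookup-++ʳ; []=⇒lookup; lookup⇒[]=)
  open import Data.Sum using (inj₁; inj₂; [_,_]′)
  open import Data.Product using (_×_; _,_)
  open import Data.Empty using (⊥-elim)
  open import Function using (id)
  open import Relation.Nullary using (¬_)
  open import Relation.Binary.PropositionalEquality
  open import Defs using (PartSizes)

  data SplitView (m n : ℕ) : Fin (m + n) → Set where
    left  : (i : Fin m) → SplitView m n (i ↑ˡ n)
    right : (j : Fin n) → SplitView m n (m ↑ʳ j)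

  splitView : ∀ m {n} (u : Fin (m + n)) → SplitView m n u
  splitView m u with splitAt m u in eq
  ... | inj₁ i = subst (SplitView m _) (splitAt⁻¹-↑ˡ eq) (left i)
  ... | inj₂ j = subst (SplitView m _) (splitAt⁻¹-↑ʳ eq) (right j)

  module _ {m n} (x : Subset m) (y : Subset n) where

    ↑ˡ∈++⁻ : ∀ {i} → i ↑ˡ n ∈ x ++ y → i ∈ x
    ↑ˡ∈++⁻ {i} h = lookup⇒[]= i x (trans (sym (lookup-++ˡ x y i)) ([]=⇒lookup h))

    ↑ʳ∈++⁻ : ∀ {j} → m ↑ʳ j ∈ x ++ y → j ∈ y
    ↑ʳ∈++⁻ {j} h = lookup⇒[]= j y (trans (sym (lookup-++ʳ x y j)) ([]=⇒lookup h))

    ↑ˡ∈++⁺ : ∀ {i} → i ∈ x → i ↑ˡ n ∈ x ++ y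
    ↑ˡ∈++⁺ {i} h = lookup⇒[]= (i ↑ˡ n) (x ++ y) (trans (lookup-++ˡ x y i) ([]=⇒lookup h))

    ↑ʳ∈++⁺ : ∀ {j} → j ∈ y → m ↑ʳ j ∈ x ++ y
    ↑ʳ∈++⁺ {j} h = lookup⇒[]= (m ↑ʳ j) (x ++ y) (trans (lookup-++ʳ x y j) ([]=⇒lookup h))

  ∣p++q∣≡∣p∣+∣q∣ : ∀ {m n} (p : Subset m) (q : Subset n) → ∣ p ++ q ∣ ≡ ∣ p ∣ + ∣ q ∣
  ∣p++q∣≡∣p∣+∣q∣ []            q = refl
  ∣p++q∣≡∣p∣+∣q∣ (inside ∷ p)  q = cong suc (∣p++q∣≡∣p∣+∣q∣ p q)
  ∣p++q∣≡∣p∣+∣q∣ (outside ∷ p) q = ∣p++q∣≡∣p∣+∣q∣ p q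

  ++-mono-⊆ : ∀ {m n} {x x′ : Subset m} {y y′ : Subset n} → x ⊆ x′ → y ⊆ y′ → x ++ y ⊆ x′ ++ y′
  ++-mono-⊆ {m} {n} {x} {x′} {y} {y′} x⊆x′ y⊆y′ {u} u∈ with splitView m u
  ... | left i  = ↑ˡ∈++⁺ x′ y′ (x⊆x′ (↑ˡ∈++⁻ x y u∈))
  ... | right j = ↑ʳ∈++⁺ x′ y′ (y⊆y′ (↑ʳ∈++⁻ x y u∈))

  -- The i-th vertex of each of the t copies of Fin q has position i; column t i is the part T_i.
  position : ∀ {q} t → Fin (t * q) → Fin q
  position {q} (suc t) u = [ id , position t ]′ (splitAt q u)

  position-↑ˡ : ∀ {q} t (i : Fin q) → position (suc t) (i ↑ˡ t * q) ≡ i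
  position-↑ˡ {q} t i = cong [ id , position t ]′ (splitAt-↑ˡ q i (t * q))

  position-↑ʳ : ∀ {q} t (j : Fin (t * q)) → position (suc t) (q ↑ʳ j) ≡ position t j
  position-↑ʳ {q} t j = cong [ id , position t ]′ (splitAt-↑ʳ q (t * q) j)

  column : ∀ {q} t → Fin q → Subset (t * q)
  column zero    i = []
  column (suc t) i = ⁅ i ⁆ ++ column t i

  ∈-column⁻ : ∀ {q} t {i : Fin q} {v} → v ∈ column t i → position t v ≡ i
  ∈-column⁻ {q} (suc t) {i} {v} v∈ with splitView q v
  ... | left j  = trans (position-↑ˡ t j) (x∈⁅y⁆⇒x≡y i (↑ˡ∈++⁻ ⁅ i ⁆ (column t i) v∈))
  ... | right w = trans (position-↑ʳ t w) (∈-column⁻ t (↑ʳ∈++⁻ ⁅ i ⁆ (column t i) v∈))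

  ∈-column⁺ : ∀ {q} t {i : Fin q} {v} → position t v ≡ i → v ∈ column t i
  ∈-column⁺ {q} (suc t) {i} {v} pos≡i with splitView q v
  ... | left j  =
    ↑ˡ∈++⁺ ⁅ i ⁆ (column t i) (subst (_∈ ⁅ i ⁆) (trans (sym pos≡i) (position-↑ˡ t j)) (x∈⁅x⁆ i))
  ... | right w = ↑ʳ∈++⁺ ⁅ i ⁆ (column t i) (∈-column⁺ t (trans (sym (position-↑ʳ t w)) pos≡i))

  ∣column∣≡t : ∀ {q} t (i : Fin q) → ∣ column t i ∣ ≡ t
  ∣column∣≡t zero    i = refl
  ∣column∣≡t (suc t) i = trans (∣p++q∣≡∣p∣+∣q∣ ⁅ i ⁆ (column t i)) (cong₂ _+_ (∣⁅x⁆∣≡1 i) (∣column∣≡t t i))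

  PartSizes-position : ∀ {q} t → PartSizes (position {q} t) t
  PartSizes-position t i = column t i , (λ v → ∈-column⁻ t , ∈-column⁺ t) , ∣column∣≡t t i

  InjectiveOn : ∀ {n q} → (Fin n → Fin q) → Subset n → Set
  InjectiveOn f e = ∀ u v → u ∈ e → v ∈ e → f u ≡ f v → u ≡ v

  module _ {q : ℕ} (F : List (Subset q)) where

    copies : ∀ t → List (Subset (t * q))
    copies zero    = L.[]
    copies (suc t) = map (_++ ⊥) F L.++ map (⊥ ++_) (copies t)

    length-copies : ∀ t → length (copies t) ≡ t * length F
    length-copies zero    = refl
    length-copies (suc t) = begin
      length (map (_++ ⊥) F L.++ map (⊥ ++_) (copies t))
        ≡⟨ length-++ (map (_++ ⊥) F) ⟩
      length (map (_++ ⊥) F) + length (map (⊥ ++_) (copies t))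
        ≡⟨ cong₂ _+_ (length-map (_++ ⊥) F) (length-map (⊥ ++_) (copies t)) ⟩
      length F + length (copies t)
        ≡⟨ cong (length F +_) (length-copies t) ⟩
      length F + t * length F
        ∎
      where open ≡-Reasoning

    copies-uniform : ∀ {r} t → All (λ e → ∣ e ∣ ≡ r) F → All (λ e → ∣ e ∣ ≡ r) (copies t)
    copies-uniform zero    _      = All.[]
    copies-uniform (suc t) F-unif =
      ++⁺ (map⁺ {f = _++ ⊥} (All.map (λ {e} → left-copy {e = e}) F-unif))
          (map⁺ {f = ⊥ ++_} (All.map (λ {f} → right-copy {f = f}) (copies-uniform t F-unif)))
      where
      left-copy : ∀ {r} {e : Subset q} → ∣ e ∣ ≡ r → ∣ e ++ ⊥ {t * q} ∣ ≡ r
      left-copy {e = e} refl =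
        trans (∣p++q∣≡∣p∣+∣q∣ e ⊥) (trans (cong (∣ e ∣ +_) (∣⊥∣≡0 (t * q))) (+-identityʳ ∣ e ∣))
      right-copy : ∀ {r} {f : Subset (t * q)} → ∣ f ∣ ≡ r → ∣ ⊥ {q} ++ f ∣ ≡ r
      right-copy {f = f} refl = trans (∣p++q∣≡∣p∣+∣q∣ (⊥ {q}) f) (cong (_+ ∣ f ∣) (∣⊥∣≡0 q))

    copies-injectiveOn-position : ∀ t → All (InjectiveOn (position t)) (copies t)
    copies-injectiveOn-position zero    = All.[]
    copies-injectiveOn-position (suc t) =
      ++⁺ (map⁺ {f = _++ ⊥} (All.tabulate (λ {e} _ → left-copy e)))
          (map⁺ {f = ⊥ ++_} (All.map right-copy (copies-injectiveOn-position t)))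
      where
      left-copy : ∀ e → InjectiveOn (position (suc t)) (e ++ ⊥)
      left-copy e u v u∈ v∈ pos≡ with splitView q u | splitView q v
      ... | left i  | left j  = cong (_↑ˡ t * q) (trans (sym (position-↑ˡ t i)) (trans pos≡ (position-↑ˡ t j)))
      ... | right w | _       = ⊥-elim (∉⊥ (↑ʳ∈++⁻ e ⊥ u∈))
      ... | left _  | right w = ⊥-elim (∉⊥ (↑ʳ∈++⁻ e ⊥ v∈))
      right-copy : ∀ {f} → InjectiveOn (position t) f → InjectiveOn (position (suc t)) (⊥ ++ f)
      right-copy {f} inj u v u∈ v∈ pos≡ with splitView q u | splitView q v
      ... | right w | right w′ = cong (q ↑ʳ_) (inj w w′ (↑ʳ∈++⁻ ⊥ f u∈) (↑ʳ∈++⁻ ⊥ f v∈)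
            (trans (sym (position-↑ʳ t w)) (trans pos≡ (position-↑ʳ t w′))))
      ... | left i  | _        = ⊥-elim (∉⊥ (↑ˡ∈++⁻ ⊥ f u∈))
      ... | right _ | left i   = ⊥-elim (∉⊥ (↑ˡ∈++⁻ ⊥ f v∈))

    copies-avoid⁻ : ∀ t {S₁ : Subset q} {S₂ : Subset (t * q)} →
                    All (λ e → ¬ e ⊆ S₁ ++ S₂) (copies (suc t)) →
                    All (λ e → ¬ e ⊆ S₁) F × All (λ e → ¬ e ⊆ S₂) (copies t)
    copies-avoid⁻ t {S₁} {S₂} avoid with ++⁻ (map (_++ ⊥) F) avoid
    ... | avoid₁ , avoid₂ = All.map left-copy (map⁻ avoid₁) , All.map right-copy (map⁻ avoid₂)
      where
      left-copy : ∀ {e} → ¬ e ++ ⊥ ⊆ S₁ ++ S₂ → ¬ e ⊆ S₁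
      left-copy ¬⊆ e⊆S₁ = ¬⊆ (++-mono-⊆ e⊆S₁ ⊥⊆)
      right-copy : ∀ {f} → ¬ ⊥ ++ f ⊆ S₁ ++ S₂ → ¬ f ⊆ S₂
      right-copy ¬⊆ f⊆S₂ = ¬⊆ (++-mono-⊆ ⊥⊆ f⊆S₂)

module RationalArithmetic where

  open import Data.Nat as ℕ using (ℕ; zero; suc)
  import Data.Nat.Properties as ℕ
  import Data.Nat.Coprimality as Coprime
  open Coprime using (1-coprimeTo)
  open import Data.Integer as ℤ using (+_; -[1+_])
  import Data.Integer.Properties as ℤ
  open import Data.Rational using (ℚ; mkℚ; 0ℚ; 1ℚ; _+_; _*_; _≤_; _/_; *≤*; nonNegative)
  open import Data.Rational.Properties
  open import Data.Product using (Σ; _×_; _,_)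
  open import Relation.Nullary using (yes; no)
  open import Relation.Binary.PropositionalEquality
  open import Algebra.Bundles using (CommutativeMonoid)
  open import Algebra.Properties.CommutativeSemigroup (CommutativeMonoid.commutativeSemigroup *-1-commutativeMonoid)
    using () renaming (interchange to *-interchange)
  open import Defs using (_^ℚ_)

  toℚ : ℕ → ℚ
  toℚ n = + n / 1

  toℚ≡mkℚ : ∀ n → toℚ n ≡ mkℚ (+ n) 0 (Coprime.sym (1-coprimeTo n))
  toℚ≡mkℚ n = normalize-coprime (Coprime.sym (1-coprimeTo n))

  toℚ-homo-+ : ∀ m n → toℚ (m ℕ.+ n) ≡ toℚ m + toℚ n
  toℚ-homo-+ m n rewrite toℚ≡mkℚ m | toℚ≡mkℚ n =
    cong (_/ 1) (sym (trans (cong₂ ℤ._+_ (ℤ.*-identityʳ (+ m)) (ℤ.*-identityʳ (+ n))) (ℤ.pos-+ m n)))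

  toℚ-homo-* : ∀ m n → toℚ (m ℕ.* n) ≡ toℚ m * toℚ n
  toℚ-homo-* m n rewrite toℚ≡mkℚ m | toℚ≡mkℚ n = cong (_/ 1) (ℤ.pos-* m n)

  toℚ-homo-^ : ∀ m r → toℚ (m ℕ.^ r) ≡ toℚ m ^ℚ r
  toℚ-homo-^ m zero    = refl
  toℚ-homo-^ m (suc r) = trans (toℚ-homo-* m (m ℕ.^ r)) (cong (toℚ m *_) (toℚ-homo-^ m r))

  toℚ-mono-≤ : ∀ {m n} → m ℕ.≤ n → toℚ m ≤ toℚ n
  toℚ-mono-≤ {m} {n} m≤n rewrite toℚ≡mkℚ m | toℚ≡mkℚ n =
    *≤* (subst₂ ℤ._≤_ (sym (ℤ.*-identityʳ (+ m))) (sym (ℤ.*-identityʳ (+ n))) (ℤ.+≤+ m≤n))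

  toℚ-cancel-≤ : ∀ {m n} → toℚ m ≤ toℚ n → m ℕ.≤ n
  toℚ-cancel-≤ {m} {n} m≤n rewrite toℚ≡mkℚ m | toℚ≡mkℚ n with m≤n
  ... | *≤* m*1≤n*1 = ℤ.drop‿+≤+ (subst₂ ℤ._≤_ (ℤ.*-identityʳ (+ m)) (ℤ.*-identityʳ (+ n)) m*1≤n*1)

  0≤toℚ : ∀ n → 0ℚ ≤ toℚ n
  0≤toℚ n = toℚ-mono-≤ {0} {n} ℕ.z≤n

  ^ℚ-distribʳ-* : ∀ x y r → (x * y) ^ℚ r ≡ x ^ℚ r * y ^ℚ r
  ^ℚ-distribʳ-* x y zero    = refl
  ^ℚ-distribʳ-* x y (suc r) = trans (cong (x * y *_) (^ℚ-distribʳ-* x y r)) (*-interchange x y (x ^ℚ r) (y ^ℚ r))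

  1^ℚr≡1 : ∀ r → 1ℚ ^ℚ r ≡ 1ℚ
  1^ℚr≡1 zero    = refl
  1^ℚr≡1 (suc r) = trans (*-identityˡ (1ℚ ^ℚ r)) (1^ℚr≡1 r)

  *-nonNeg : ∀ {p q} → 0ℚ ≤ p → 0ℚ ≤ q → 0ℚ ≤ p * q
  *-nonNeg {p} {q} 0≤p 0≤q = let instance _ = nonNegative 0≤q in
    ≤-trans (≤-reflexive (sym (*-zeroˡ q))) (*-monoʳ-≤-nonNeg q 0≤p)

  ^ℚ-nonNeg : ∀ {x} r → 0ℚ ≤ x → 0ℚ ≤ x ^ℚ r
  ^ℚ-nonNeg zero    0≤x = 0≤toℚ 1
  ^ℚ-nonNeg (suc r) 0≤x = *-nonNeg 0≤x (^ℚ-nonNeg r 0≤x)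

  ^ℚ-monoˡ-≤ : ∀ {x y} r → 0ℚ ≤ x → x ≤ y → x ^ℚ r ≤ y ^ℚ r
  ^ℚ-monoˡ-≤ zero    _   _   = ≤-refl
  ^ℚ-monoˡ-≤ {x} {y} (suc r) 0≤x x≤y =
    let instance _ = nonNegative (^ℚ-nonNeg r 0≤x)
        instance _ = nonNegative (≤-trans 0≤x x≤y)
    in ≤-trans (*-monoʳ-≤-nonNeg (x ^ℚ r) x≤y) (*-monoˡ-≤-nonNeg y (^ℚ-monoˡ-≤ r 0≤x x≤y))

  archimedean : ∀ y → Σ ℕ λ n → y ≤ toℚ n
  archimedean y@(mkℚ (+ m) d-1 _) = m , subst (y ≤_) (sym (toℚ≡mkℚ m))
    (*≤* (subst₂ ℤ._≤_ (ℤ.pos-* m 1) (ℤ.pos-* m (suc d-1)) (ℤ.+≤+ (ℕ.*-monoʳ-≤ m (ℕ.s≤s ℕ.z≤n)))))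
  archimedean y@(mkℚ -[1+ m ] d-1 _) = 0 , subst (y ≤_) (sym (toℚ≡mkℚ 0)) (*≤* ℤ.-≤+)

  toℚ-ceiling : ∀ y → 0ℚ ≤ y → Σ ℕ λ k → y ≤ toℚ k × toℚ k ≤ y + 1ℚ
  toℚ-ceiling y 0≤y = let n , y≤n = archimedean y in search n y≤n
    where
    search : ∀ n → y ≤ toℚ n → Σ ℕ λ k → y ≤ toℚ k × toℚ k ≤ y + 1ℚ
    search zero    y≤0 = 0 , y≤0 , ≤-trans 0≤y (≤-trans (≤-reflexive (sym (+-identityʳ y))) (+-monoʳ-≤ y (0≤toℚ 1)))
    search (suc n) y≤1+n with y ≤? toℚ n
    ... | yes y≤n = search n y≤n
    ... | no  y≰n = suc n , y≤1+n ,
      ≤-trans (≤-reflexive (trans (cong toℚ (ℕ.+-comm 1 n)) (toℚ-homo-+ n 1))) (+-monoˡ-≤ 1ℚ (<⇒≤ (≰⇒> y≰n)))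

  ∃-toℚ-∈[2x,4x] : ∀ x → 1ℚ ≤ x → Σ ℕ λ k → x + x ≤ toℚ k × toℚ k ≤ x * toℚ 4
  ∃-toℚ-∈[2x,4x] x 1≤x = let k , 2x≤k , k≤2x+1 = toℚ-ceiling (x + x) (≤-trans 0≤x x≤2x) in k , 2x≤k , (begin
    toℚ k                  ≤⟨ k≤2x+1 ⟩
    (x + x) + 1ℚ           ≤⟨ +-monoʳ-≤ (x + x) (≤-trans 1≤x x≤2x) ⟩
    (x + x) + (x + x)      ≡⟨ cong₂ _+_ x*2≡x+x x*2≡x+x ⟨
    x * toℚ 2 + x * toℚ 2  ≡⟨ *-distribˡ-+ x (toℚ 2) (toℚ 2) ⟨
    x * toℚ 4              ∎)
    where
    open ≤-Reasoning
    0≤x = ≤-trans (0≤toℚ 1) 1≤x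
    x≤2x : x ≤ x + x
    x≤2x = ≤-trans (≤-reflexive (sym (+-identityʳ x))) (+-monoʳ-≤ x 0≤x)
    x*2≡x+x : x * toℚ 2 ≡ x + x
    x*2≡x+x = trans (*-distribˡ-+ x 1ℚ 1ℚ) (cong₂ _+_ (*-identityʳ x) (*-identityʳ x))

module HypergraphFromList where

  open import Data.Nat using (_≤_)
  open import Data.Bool using () renaming (_≟_ to _≟ᵇ_)
  open import Data.List using (List; length; deduplicate)
  open import Data.List.Properties using (length-deduplicate)
  open import Data.List.Relation.Unary.All using (All)
  open import Data.List.Relation.Unary.All.Properties using (deduplicate⁺; deduplicate⁻)
  open import Data.List.Relation.Unary.Unique.DecPropositional.Properties using (deduplicate-!)
  open import Data.Vec.Properties using (≡-dec)
  open import Data.Fin.Subset using (Subset; _⊆_)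
  open import Relation.Nullary using (¬_)
  open import Relation.Binary.PropositionalEquality using (subst)
  open import Defs

  fromList : ∀ {n} → List (Subset n) → Hypergraph n
  fromList es = record { edges = deduplicate (≡-dec _≟ᵇ_) es ; unique = deduplicate-! (≡-dec _≟ᵇ_) es }

  All-fromList⁺ : ∀ {n} {P : Subset n → Set} {es} → All P es → All P (edges (fromList es))
  All-fromList⁺ = deduplicate⁺ (≡-dec _≟ᵇ_)

  numEdges-fromList : ∀ {n} (es : List (Subset n)) → numEdges (fromList es) ≤ length es
  numEdges-fromList = length-deduplicate (≡-dec _≟ᵇ_)

  Independent-fromList⁻ : ∀ {n} {S : Subset n} es → Independent (fromList es) S → All (λ e → ¬ e ⊆ S) es
  Independent-fromList⁻ {S = S} = deduplicate⁻ (≡-dec _≟ᵇ_) (subst (λ e → ¬ e ⊆ S))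

open import Defs
open import Data.Nat using (ℕ; _≥_) renaming (_*_ to _*ℕ_)
open import Data.Fin using (Fin)
open import Data.Fin.Subset using (Subset; ∣_∣)
open import Data.Product using (Σ; _×_)
open import Data.Integer using (+_)
open import Data.Rational using (ℚ; 1ℚ; _<_; _≤_; _*_; _÷_; 1/_; Positive)
open import Data.Rational.Properties using (pos⇒nonZero)

import Data.Nat as ℕ
import Data.Nat.Properties as ℕ
open import Data.Nat.Combinatorics using (_C_)
open import Data.Rational using (_+_; nonNegative)
open import Data.Rational.Properties
  hiding (pos⇒nonZero)
open import Data.Product using (_,_; proj₁; proj₂)
open import Data.List using (List; length)
open import Data.List.Relation.Unary.All using (All)
open import Data.List.Relation.Unary.All.Properties using (All¬⇒¬Any)
open import Data.List.Relation.Unary.Any using (Any)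
open import Data.Fin.Subset using (_⊆_)
open import Relation.Nullary using (¬_; yes; no; contradiction)
open import Relation.Unary using (Decidable)
open import Relation.Binary.PropositionalEquality
open import Data.Vec as Vec using ()
open import Algebra.Bundles using (CommutativeMonoid)
import Algebra.Properties.CommutativeSemigroup as CommSemigroupProperties
module ℕ-*-Properties = CommSemigroupProperties ℕ.*-commutativeSemigroup
module ℚ-*-Properties = CommSemigroupProperties (CommutativeMonoid.commutativeSemigroup *-1-commutativeMonoid)
open RationalArithmetic
open Binomial using (nCk≤m*sCk)
open CoveringFamily using (covering-family)

module _ (a : ℚ) .{{_ : Positive a}} where

  private instance
    a≢0 = pos⇒nonZero a

  1≤[1/a]^r : a ≤ 1ℚ → ∀ r → 1ℚ ≤ (1/ a) ^ℚ r
  1≤[1/a]^r a≤1 r = ≤-trans (≤-reflexive (sym (1^ℚr≡1 r))) (^ℚ-monoˡ-≤ r (0≤toℚ 1) 1≤1/a)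
    where
    instance _ = nonNegative (<⇒≤ (positive⁻¹ (1/ a) {{1/pos⇒pos a}}))
    1≤1/a : 1ℚ ≤ 1/ a
    1≤1/a = begin
      1ℚ          ≡⟨ *-inverseʳ a ⟨
      a * 1/ a    ≤⟨ *-monoʳ-≤-nonNeg (1/ a) a≤1 ⟩
      1ℚ * 1/ a   ≡⟨ *-identityˡ (1/ a) ⟩
      1/ a        ∎
      where open ≤-Reasoning

  [1/a]^r*a^r≡1 : ∀ r → (1/ a) ^ℚ r * a ^ℚ r ≡ 1ℚ
  [1/a]^r*a^r≡1 r = begin-equality
    (1/ a) ^ℚ r * a ^ℚ r    ≡⟨ ^ℚ-distribʳ-* (1/ a) a r ⟨
    (1/ a * a) ^ℚ r         ≡⟨ cong (_^ℚ r) (*-inverseˡ a) ⟩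
    1ℚ ^ℚ r                 ≡⟨ 1^ℚr≡1 r ⟩
    1ℚ                      ∎
    where open ≤-Reasoning

  2*q^r≤k*s^r : ∀ r q s k → (1/ a) ^ℚ r + (1/ a) ^ℚ r ≤ toℚ k → a * toℚ q ≤ toℚ s →
                2 *ℕ q ℕ.^ r ℕ.≤ k *ℕ s ℕ.^ r
  2*q^r≤k*s^r r q s k 2x≤k aq≤s = toℚ-cancel-≤ (begin
    toℚ (2 *ℕ q ℕ.^ r)          ≡⟨ toℚ-homo-* 2 (q ℕ.^ r) ⟩
    toℚ 2 * Q                   ≡⟨ two ⟨
    (x + x) * (A * Q)           ≤⟨ *-monoʳ-≤-nonNeg (A * Q) {{nonNegative (*-nonNeg 0≤A (0≤toℚ (q ℕ.^ r)))}} 2x≤k ⟩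
    toℚ k * (A * Q)             ≡⟨ cong (λ z → toℚ k * (A * z)) (toℚ-homo-^ q r) ⟩
    toℚ k * (A * toℚ q ^ℚ r)    ≡⟨ cong (toℚ k *_) (^ℚ-distribʳ-* a (toℚ q) r) ⟨
    toℚ k * (a * toℚ q) ^ℚ r    ≤⟨ *-monoˡ-≤-nonNeg (toℚ k) {{nonNegative (0≤toℚ k)}} (^ℚ-monoˡ-≤ r 0≤aq aq≤s) ⟩
    toℚ k * toℚ s ^ℚ r          ≡⟨ cong (toℚ k *_) (toℚ-homo-^ s r) ⟨
    toℚ k * toℚ (s ℕ.^ r)       ≡⟨ toℚ-homo-* k (s ℕ.^ r) ⟨
    toℚ (k *ℕ s ℕ.^ r)          ∎)
    where
    open ≤-Reasoning
    x = (1/ a) ^ℚ r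
    A = a ^ℚ r
    Q = toℚ (q ℕ.^ r)
    0≤a = <⇒≤ (positive⁻¹ a)
    0≤A = ^ℚ-nonNeg r 0≤a
    0≤aq = *-nonNeg 0≤a (0≤toℚ q)
    two : (x + x) * (A * Q) ≡ toℚ 2 * Q
    two = begin-equality
      (x + x) * (A * Q)       ≡⟨ *-assoc (x + x) A Q ⟨
      (x + x) * A * Q         ≡⟨ cong (_* Q) (*-distribʳ-+ A x x) ⟩
      (x * A + x * A) * Q     ≡⟨ cong (λ z → (z + z) * Q) ([1/a]^r*a^r≡1 r) ⟩
      toℚ 2 * Q               ∎

  ÷-≤⇒≤-* : ∀ {p q} → (p ÷ a) ≤ q → p ≤ a * q
  ÷-≤⇒≤-* {p} {q} p/a≤q = begin
    p                  ≡⟨ *-identityʳ p ⟨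
    p * 1ℚ             ≡⟨ cong (p *_) (*-inverseˡ a) ⟨
    p * (1/ a * a)     ≡⟨ *-assoc p (1/ a) a ⟨
    (p ÷ a) * a        ≤⟨ *-monoʳ-≤-nonNeg a {{pos⇒nonNeg a}} p/a≤q ⟩
    q * a              ≡⟨ *-comm q a ⟩
    a * q              ∎
    where open ≤-Reasoning

  r≤s×qCr≤k*sCr : ∀ r q s k → 1 ℕ.≤ r → toℚ (r *ℕ r) ≤ a * toℚ q → (1/ a) ^ℚ r + (1/ a) ^ℚ r ≤ toℚ k →
                  a * toℚ q ≤ toℚ s → r ℕ.≤ s × q C r ℕ.≤ k *ℕ (s C r)
  r≤s×qCr≤k*sCr r q s k 1≤r rr≤aq 2x≤k aq≤s =
    ℕ.≤-trans (ℕ.m≤m*n r r {{ℕ.>-nonZero 1≤r}}) rr≤s ,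
    nCk≤m*sCk {q} {s} {r} {k} (ℕ.≤-trans (ℕ.*-mono-≤ 1≤r 1≤r) rr≤s) rr≤s (2*q^r≤k*s^r r q s k 2x≤k aq≤s)
    where
    rr≤s : r *ℕ r ℕ.≤ s
    rr≤s = toℚ-cancel-≤ (≤-trans rr≤aq aq≤s)

  base-family : a < 1ℚ → ∀ r q → 1 ℕ.≤ r → toℚ (r *ℕ r) ≤ a * toℚ q →
    Σ (List (Subset q)) λ F →
      All (λ e → ∣ e ∣ ≡ r) F ×
      (∀ S → All (λ e → ¬ e ⊆ S) F → toℚ ∣ S ∣ < a * toℚ q) ×
      toℚ (length F) ≤ (1/ a) ^ℚ r * toℚ (4 *ℕ q)
  base-family a<1 r q 1≤r rr≤aq =
    let F , |F|≡kq , F-uniform , cover = covering-family r k {{q≢0}} Big? r≤q dense in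
    F , F-uniform , independent cover , size {F} |F|≡kq
    where
    x = (1/ a) ^ℚ r
    k-choice = ∃-toℚ-∈[2x,4x] x (1≤[1/a]^r (<⇒≤ a<1) r)
    k = proj₁ k-choice
    Big : Subset q → Set
    Big S = a * toℚ q ≤ toℚ ∣ S ∣
    Big? : Decidable Big
    Big? S = a * toℚ q ≤? toℚ ∣ S ∣
    dense : ∀ S → Big S → r ℕ.≤ ∣ S ∣ × q C r ℕ.≤ k *ℕ (∣ S ∣ C r)
    dense S = r≤s×qCr≤k*sCr r q ∣ S ∣ k 1≤r rr≤aq (proj₁ (proj₂ k-choice))
    aq≤q : a * toℚ q ≤ toℚ q
    aq≤q = ≤-trans (*-monoʳ-≤-nonNeg (toℚ q) {{nonNegative (0≤toℚ q)}} (<⇒≤ a<1)) (≤-reflexive (*-identityˡ (toℚ q)))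
    r≤q : r ℕ.≤ q
    r≤q = proj₁ (r≤s×qCr≤k*sCr r q q k 1≤r rr≤aq (proj₁ (proj₂ k-choice)) aq≤q)
    q≢0 : ℕ.NonZero q
    q≢0 = ℕ.>-nonZero (ℕ.≤-trans 1≤r r≤q)
    independent : ∀ {F : List (Subset q)} → (∀ S → Big S → Any (_⊆ S) F) →
                  ∀ S → All (λ e → ¬ e ⊆ S) F → toℚ ∣ S ∣ < a * toℚ q
    independent cover S avoid with Big? S
    ... | yes big  = contradiction (cover S big) (All¬⇒¬Any avoid)
    ... | no  ¬big = ≰⇒> ¬big
    size : ∀ {F : List (Subset q)} → length F ≡ k *ℕ q → toℚ (length F) ≤ x * toℚ (4 *ℕ q)
    size {F} |F|≡kq = begin
      toℚ (length F)          ≡⟨ trans (cong toℚ |F|≡kq) (toℚ-homo-* k q) ⟩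
      toℚ k * toℚ q           ≤⟨ *-monoʳ-≤-nonNeg (toℚ q) {{nonNegative (0≤toℚ q)}} (proj₂ (proj₂ k-choice)) ⟩
      x * toℚ 4 * toℚ q       ≡⟨ *-assoc x (toℚ 4) (toℚ q) ⟩
      x * (toℚ 4 * toℚ q)     ≡⟨ cong (x *_) (toℚ-homo-* 4 q) ⟨
      x * toℚ (4 *ℕ q)        ∎
      where open ≤-Reasoning

module _ {q} (F : List (Subset q)) where

  open DisjointCopies using (copies; copies-avoid⁻; ∣p++q∣≡∣p∣+∣q∣; length-copies)

  module _ (α : ℚ) (base : ∀ S → All (λ e → ¬ e ⊆ S) F → toℚ ∣ S ∣ < α * toℚ q) where

    mutual
      independent-copies-< : ∀ t (S : Subset (ℕ.suc t *ℕ q)) → All (λ e → ¬ e ⊆ S) (copies F (ℕ.suc t)) →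
                             toℚ ∣ S ∣ < α * toℚ (ℕ.suc t *ℕ q)
      independent-copies-< t S avoid with Vec.splitAt q S
      ... | S₁ , S₂ , refl with copies-avoid⁻ F t avoid
      ...   | avoid₁ , avoid₂ = begin-strict
        toℚ (∣ S₁ Vec.++ S₂ ∣)             ≡⟨ cong toℚ (∣p++q∣≡∣p∣+∣q∣ S₁ S₂) ⟩
        toℚ (∣ S₁ ∣ ℕ.+ ∣ S₂ ∣)            ≡⟨ toℚ-homo-+ ∣ S₁ ∣ ∣ S₂ ∣ ⟩
        toℚ (∣ S₁ ∣) + toℚ (∣ S₂ ∣)        <⟨ +-mono-<-≤ (base S₁ avoid₁) (independent-copies-≤ t S₂ avoid₂) ⟩
        α * toℚ q + α * toℚ (t *ℕ q)       ≡⟨ *-distribˡ-+ α (toℚ q) (toℚ (t *ℕ q)) ⟨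
        α * (toℚ q + toℚ (t *ℕ q))         ≡⟨ cong (α *_) (toℚ-homo-+ q (t *ℕ q)) ⟨
        α * toℚ (q ℕ.+ t *ℕ q)             ∎
        where open ≤-Reasoning

      independent-copies-≤ : ∀ t (S : Subset (t *ℕ q)) → All (λ e → ¬ e ⊆ S) (copies F t) →
                             toℚ ∣ S ∣ ≤ α * toℚ (t *ℕ q)
      independent-copies-≤ ℕ.zero    Vec.[] _     = ≤-reflexive (sym (*-zeroʳ α))
      independent-copies-≤ (ℕ.suc t) S      avoid = <⇒≤ (independent-copies-< t S avoid)

  toℚ-length-copies≤ : ∀ c m t → toℚ (length F) ≤ c * toℚ (m *ℕ q) →
                       toℚ (length (copies F t)) ≤ c * toℚ (m *ℕ (t *ℕ q))
  toℚ-length-copies≤ c m t |F|≤ = begin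
    toℚ (length (copies F t))          ≡⟨ trans (cong toℚ (length-copies F t)) (toℚ-homo-* t (length F)) ⟩
    toℚ t * toℚ (length F)             ≤⟨ *-monoˡ-≤-nonNeg (toℚ t) {{nonNegative (0≤toℚ t)}} |F|≤ ⟩
    toℚ t * (c * toℚ (m *ℕ q))         ≡⟨ ℚ-*-Properties.x∙yz≈y∙xz (toℚ t) c (toℚ (m *ℕ q)) ⟩
    c * (toℚ t * toℚ (m *ℕ q))         ≡⟨ cong (c *_) (toℚ-homo-* t (m *ℕ q)) ⟨
    c * toℚ (t *ℕ (m *ℕ q))            ≡⟨ cong (λ n → c * toℚ n) (ℕ-*-Properties.x∙yz≈y∙xz t m q) ⟩
    c * toℚ (m *ℕ (t *ℕ q))            ∎
    where open ≤-Reasoning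

lemma1 : (a : ℚ) → .{{_ : Positive a}} → a < 1ℚ →
    (t r q : ℕ) → t ≥ 1 → r ≥ 2 →
    ((+ (r *ℕ r) Data.Rational./ 1) ÷ a) {{pos⇒nonZero a}} ≤ (+ q Data.Rational./ 1) →
    Σ (Hypergraph (t *ℕ q)) (λ H →
      Uniform r H ×
      Σ (Fin (t *ℕ q) → Fin q) (λ part →
        PartSizes part t ×
        Transversal H part ×
        ((S : Subset (t *ℕ q)) → Independent H S →
          (+ ∣ S ∣ Data.Rational./ 1) < a * (+ (t *ℕ q) Data.Rational./ 1)) ×
        (+ numEdges H Data.Rational./ 1)
          ≤ (((1/ a) {{pos⇒nonZero a}}) ^ℚ r) * (+ (4 *ℕ (t *ℕ q)) Data.Rational./ 1)))
lemma1 a a<1 ℕ.zero    r q () r≥2 rr/a≤q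
lemma1 a a<1 (ℕ.suc t) r q _  r≥2 rr/a≤q =
  let F , F-uniform , F-independent , F-size = base-family a a<1 r q (ℕ.<⇒≤ r≥2) (÷-≤⇒≤-* a rr/a≤q)
      E = copies F (ℕ.suc t)
  in fromList E ,
     All-fromList⁺ (copies-uniform F (ℕ.suc t) F-uniform) ,
     position (ℕ.suc t) ,
     PartSizes-position (ℕ.suc t) ,
     All-fromList⁺ (copies-injectiveOn-position F (ℕ.suc t)) ,
     (λ S independent → independent-copies-< F a F-independent t S (Independent-fromList⁻ E independent)) ,
     ≤-trans (toℚ-mono-≤ (numEdges-fromList E)) (toℚ-length-copies≤ F ((1/ a) {{pos⇒nonZero a}} ^ℚ r) 4 (ℕ.suc t) F-size)
  where
  open DisjointCopies
  open HypergraphFromList
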